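{- Fix $n\ge1$. For all integers $m,k\ge1$, $$c_{n,m,k}(1)=b_{n,k}\binom{m-1}{k-1}.$$
   Context: Words are finite sequences of positive integers; $|w|$ is the length of $w$. $P(w)$ is the insertion tableau of $w$ under the Robinson–Schensted–Knuth (row-insertion) correspondence, and $C(u)=\{w : P(uw)=P(wu)\}$ (juxtaposition is concatenation). Define $c_{n,m,k}(u)$ as the number of $w\in C(u)$ with $|w|=n$, $\max w\le m$, and exactly $k$ distinct letters in $w$. A word $w$ is $k$-packed if $\max w=k$ and every element of $\{1,\dots,k\}$ occurs in $w$. Let $b_{n,k}$ be the number of $k$-packed words $w\in C(1)$ with $|w|=n$. -}

module Defs where

open import Data.Nat using (ℕ; zero; suc; _+_; _∸_; _⊔_; _<ᵇ_; _≟_)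
open import Data.Bool using (true; false)
open import Data.Maybe using (Maybe; just; nothing)
open import Data.Product using (_×_; _,_)
open import Data.List using (List; []; _∷_; [_]; _++_; foldl; foldr; length; filter; map; concatMap; deduplicate)
open import Data.List.Properties using (≡-dec)
open import Data.List.Membership.Propositional using (_∈_)
open import Data.List.Membership.DecPropositional _≟_ using (_∈?_)
open import Data.List.Relation.Unary.All using (All; all?)
open import Relation.Nullary using (Dec)
open import Relation.Nullary.Decidable using (_×-dec_)
open import Relation.Binary.PropositionalEquality using (_≡_)

-- Words are lists of positive integers; tableaux are lists of rows (top row first).
Word : Set
Word = List ℕ

Tableau : Set
Tableau = List (List ℕ)

insertRow : ℕ → List ℕ → List ℕ × Maybe ℕ
insertRow x [] = [ x ] , nothing
insertRow x (y ∷ ys) with x <ᵇ y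
... | true = x ∷ ys , just y
... | false with insertRow x ys
...   | ys′ , b = y ∷ ys′ , b

insertT : ℕ → Tableau → Tableau
insertT x [] = [ [ x ] ]
insertT x (r ∷ rs) with insertRow x r
... | r′ , nothing = r′ ∷ rs
... | r′ , just y = r′ ∷ insertT y rs

P : Word → Tableau
P w = foldl (λ t x → insertT x t) [] w

_≟T_ : (s t : Tableau) → Dec (s ≡ t)
_≟T_ = ≡-dec (≡-dec _≟_)

InC : Word → Word → Set
InC u w = P (u ++ w) ≡ P (w ++ u)

inC? : (u w : Word) → Dec (InC u w)
inC? u w = P (u ++ w) ≟T P (w ++ u)

range1 : ℕ → List ℕ
range1 zero = []
range1 (suc m) = range1 m ++ [ suc m ]

words : ℕ → ℕ → List Word
words m zero = [ [] ]
words m (suc n) = concatMap (λ a → map (a ∷_) (words m n)) (range1 m)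

distinct : Word → ℕ
distinct w = length (deduplicate _≟_ w)

maxW : Word → ℕ
maxW = foldr _⊔_ 0

c : ℕ → ℕ → ℕ → Word → ℕ
c n m k u = length (filter (λ w → inC? u w ×-dec (distinct w ≟ k)) (words m n))

Packed : ℕ → Word → Set
Packed k w = (maxW w ≡ k) × All (λ i → i ∈ w) (range1 k)

packed? : (k : ℕ) (w : Word) → Dec (Packed k w)
packed? k w = (maxW w ≟ k) ×-dec all? (λ i → i ∈? w) (range1 k)

-- b_{n,k}: number of k-packed words w ∈ C(1) with |w| = n
-- (a k-packed word has all letters in {1..k}, so enumerating words k n is exhaustive).
b : ℕ → ℕ → ℕ
b n k = length (filter (λ w → packed? k w ×-dec inC? [ 1 ] w) (words k n))

module Submission where

-- Row insertion only compares letters, so P commutes with every strictly increasing renaming of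
-- the letters, and C(1) is invariant under those that fix 1. A nonempty word w of positive letters
-- lies in C(1) only if 1 ∈ w: otherwise inserting 1 after w bumps the first entry of the first row
-- of P(w), whereas inserting it before w only lengthens that row. So a word of C(1) over [m] with
-- k distinct letters is a k-packed word of C(1) renamed along a k-subset of [m] containing 1.
-- To count these, let N(j, a) be the number of such words over [j + a] using every letter of
-- [j], with j ≥ 1. Splitting on whether j + 1 occurs, and closing the gap at j + 1 when it does
-- not, gives Pascal's rule N(j, a + 1) = N(j + 1, a) + N(j, a).

open import Defs
open import Level using (Level)
open import Data.Bool using (true; false)
open import Data.Empty using (⊥; ⊥-elim)
open import Data.Nat using (ℕ; zero; suc; _+_; _*_; _∸_; _<_; _≤_; _≥_; _<ᵇ_; _<?_; _≤?_; s≤s; z≤n)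
open import Data.Nat.Properties
  using (_≟_; +-suc; +-identityʳ; +-comm; *-comm; *-distribʳ-+; ≤-refl; ≤-trans; ≤-antisym; <-trans; <-irrefl;
         <-asym; <-cmp; <⇒≢; <⇒≱; ≤⇒≯; ≰⇒>; ≤∧≢⇒<; <⇒<ᵇ; 1+n≢n; 1+n≰n; m≤m+n; m≤n+m; m≤n⇒m≤1+n;
         m≤n⇒m<n∨m≡n; m≤m⊔n; m≤n⊔m; ⊔-lub; module ≤-Reasoning)
open import Data.Nat.Combinatorics using (_C_; nCk+nC[k+1]≡[n+1]C[k+1])
open import Data.List using (List; []; _∷_; [_]; _++_; map; filter; concatMap; length; foldl; applyUpTo; deduplicate)
open import Data.List.Properties
  using (∷-injective; ++-identityʳ; map-++; map-∘; map-id-local; map-injective; length-map; concatMap-map;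
         concatMap-cong; map-concatMap; foldl-++; applyUpTo-∷ʳ; length-applyUpTo; filter-++; filter-accept;
         filter-reject; filter-all; filter-none; filter-notAll; filter-≐)
open import Data.List.Relation.Unary.All as All using (All; []; _∷_; all?)
open import Data.List.Relation.Unary.All.Properties using (¬Any⇒All¬; All¬⇒¬Any; ∷ʳ⁺; ∷ʳ⁻; concat⁺)
import Data.List.Relation.Unary.All.Properties as All
open import Data.List.Relation.Unary.Any as Any using (here; there)
open import Data.List.Relation.Unary.AllPairs using ([]; _∷_)
open import Data.List.Relation.Unary.Unique.Propositional using (Unique)
import Data.List.Relation.Unary.Unique.Propositional.Properties as Unique
open import Data.List.Relation.Unary.Unique.DecPropositional.Properties _≟_ using (deduplicate-!)
open import Data.List.Membership.Propositional using (_∈_)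
open import Data.List.Membership.Propositional.Properties
  using (∈-filter⁺; ∈-applyUpTo⁻; ∈-deduplicate⁺; ∈-deduplicate⁻; ∈-map⁺; ∈-map⁻)
open import Data.List.Membership.DecPropositional _≟_ using (_∈?_)
open import Data.List.Relation.Binary.Subset.Propositional using (_⊆_)
import Data.List.Relation.Binary.Subset.Propositional.Properties as Subset
import Data.Maybe as Maybe
open import Data.Maybe using (just; nothing)
import Data.Product as Product
open import Data.Product using (_×_; _,_; proj₁; proj₂; uncurry)
open import Data.Sum using (inj₁; inj₂)
open import Function using (_∘_; _⇔_; mk⇔; Equivalence; Injective)
open import Relation.Binary using (DecidableEquality; _Preserves_⟶_; tri<; tri≈; tri>)
open import Relation.Binary.PropositionalEquality
  using (_≡_; _≢_; refl; sym; trans; cong; cong₂; subst; module ≡-Reasoning)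
open import Relation.Nullary using (yes; no; does; ¬?; contradiction)
open import Relation.Nullary.Decidable using (does-⇔; dec-false; _×-dec_)
open import Relation.Unary using (Pred; Decidable; _∩_; ∁; _≐_)
open import Relation.Unary.Properties using (_∩?_; ∁?)

private variable
  ℓ ℓ′ p q : Level
  A : Set ℓ
  B : Set ℓ′

filter-map : {P : Pred B p} (P? : Decidable P) (f : A → B) (xs : List A) →
  filter P? (map f xs) ≡ map f (filter (P? ∘ f) xs)
filter-map P? f [] = refl
filter-map P? f (x ∷ xs) with does (P? (f x))
... | true  = cong (f x ∷_) (filter-map P? f xs)
... | false = filter-map P? f xs

filter-∩ : {P : Pred A p} {Q : Pred A q} (P? : Decidable P) (Q? : Decidable Q) (xs : List A) →
  filter (P? ∩? Q?) xs ≡ filter P? (filter Q? xs)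
filter-∩ P? Q? [] = refl
filter-∩ P? Q? (x ∷ xs) with P? x | Q? x
... | yes px | yes _ = trans (cong (x ∷_) (filter-∩ P? Q? xs)) (sym (filter-accept P? px))
... | no ¬px | yes _ = trans (filter-∩ P? Q? xs) (sym (filter-reject P? ¬px))
... | yes _  | no  _ = filter-∩ P? Q? xs
... | no  _  | no  _ = filter-∩ P? Q? xs

length-filter-∩∁ : {P : Pred A p} {Q : Pred A q} (P? : Decidable P) (Q? : Decidable Q) (xs : List A) →
  length (filter P? xs) ≡ length (filter (P? ∩? Q?) xs) + length (filter (P? ∩? ∁? Q?) xs)
length-filter-∩∁ P? Q? [] = refl
length-filter-∩∁ P? Q? (x ∷ xs) with P? x | Q? x
... | yes _ | yes _ = cong suc (length-filter-∩∁ P? Q? xs)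
... | yes _ | no  _ = trans (cong suc (length-filter-∩∁ P? Q? xs)) (sym (+-suc _ _))
... | no  _ | _     = length-filter-∩∁ P? Q? xs

filter-≐-local : {P : Pred A p} {Q : Pred A q} (P? : Decidable P) (Q? : Decidable Q) {xs : List A} →
  All (λ x → P x ⇔ Q x) xs → filter P? xs ≡ filter Q? xs
filter-≐-local P? Q? [] = refl
filter-≐-local P? Q? {x ∷ xs} (P⇔Q ∷ Ps⇔Qs) with P? x | Q? x
... | yes _  | yes _  = cong (x ∷_) (filter-≐-local P? Q? Ps⇔Qs)
... | no  _  | no  _  = filter-≐-local P? Q? Ps⇔Qs
... | yes px | no ¬qx = contradiction (Equivalence.to P⇔Q px) ¬qx
... | no ¬px | yes qx = contradiction (Equivalence.from P⇔Q qx) ¬px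

∈-map-fixpoint : ∀ {f : A → A} {x : A} {w} → Injective _≡_ _≡_ f → f x ≡ x → x ∈ map f w ⇔ x ∈ w
∈-map-fixpoint {f = f} {x} f-inj fx≡x = mk⇔ to from
  where
  to : ∀ {w} → x ∈ map f w → x ∈ w
  to x∈fw with y , y∈w , x≡fy ← ∈-map⁻ f x∈fw = subst (_∈ _) (sym (f-inj (trans fx≡x x≡fy))) y∈w
  from : ∀ {w} → x ∈ w → x ∈ map f w
  from x∈w = subst (_∈ _) fx≡x (∈-map⁺ f x∈w)

wordsOver : List A → ℕ → List (List A)
wordsOver as zero    = [ [] ]
wordsOver as (suc n) = concatMap (λ a → map (a ∷_) (wordsOver as n)) as

wordsOver-map : (f : A → B) (as : List A) (n : ℕ) →
  wordsOver (map f as) n ≡ map (map f) (wordsOver as n)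
wordsOver-map f as zero = refl
wordsOver-map f as (suc n) = begin
  concatMap (λ y → map (y ∷_) (wordsOver (map f as) n)) (map f as)
    ≡⟨ concatMap-map _ f as ⟩
  concatMap (λ a → map (f a ∷_) (wordsOver (map f as) n)) as
    ≡⟨ concatMap-cong (λ a → cong (map (f a ∷_)) (wordsOver-map f as n)) as ⟩
  concatMap (λ a → map (f a ∷_) (map (map f) ws)) as
    ≡⟨ concatMap-cong (λ a → trans (sym (map-∘ ws)) (map-∘ ws)) as ⟩
  concatMap (λ a → map (map f) (map (a ∷_) ws)) as
    ≡⟨ map-concatMap (map f) _ as ⟨
  map (map f) (concatMap (λ a → map (a ∷_) ws) as)
    ∎
  where
  open ≡-Reasoning
  ws = wordsOver as n

wordsOver-All : (as : List A) (n : ℕ) → All (λ w → length w ≡ n × All (_∈ as) w) (wordsOver as n)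
wordsOver-All as zero    = (refl , []) ∷ []
wordsOver-All as (suc n) = concat⁺ (All.map⁺ (All.tabulate λ x∈as →
  All.map⁺ (All.map (λ (len , w⊆as) → cong suc len , x∈as ∷ w⊆as) (wordsOver-All as n))))

module _ {P : Pred A p} (P? : Decidable P) where

  filter-all?-wordsOver : (as : List A) (n : ℕ) →
    filter (all? P?) (wordsOver as n) ≡ wordsOver (filter P? as) n
  filter-all?-wordsOver as zero = refl
  filter-all?-wordsOver as (suc n) = trans (prepend-each as)
    (cong (λ ws′ → concatMap (λ a → map (a ∷_) ws′) (filter P? as)) (filter-all?-wordsOver as n))
    where
    ws = wordsOver as n
    prepend-each : ∀ bs → filter (all? P?) (concatMap (λ a → map (a ∷_) ws) bs)
                          ≡ concatMap (λ a → map (a ∷_) (filter (all? P?) ws)) (filter P? bs)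
    prepend-each [] = refl
    prepend-each (x ∷ xs) with P? x
    ... | yes px = trans (filter-++ (all? P?) (map (x ∷_) ws) _) (cong₂ _++_ accept (prepend-each xs))
      where
      accept : filter (all? P?) (map (x ∷_) ws) ≡ map (x ∷_) (filter (all? P?) ws)
      accept = trans (filter-map (all? P?) (x ∷_) ws)
                     (cong (map (x ∷_)) (filter-≐ _ (all? P?) (All.tail , (px ∷_)) ws))
    ... | no ¬px = trans (filter-++ (all? P?) (map (x ∷_) ws) _) (cong₂ _++_ reject (prepend-each xs))
      where
      reject : filter (all? P?) (map (x ∷_) ws) ≡ []
      reject = trans (filter-map (all? P?) (x ∷_) ws)
                     (cong (map (x ∷_)) (filter-none _ (All.universal (λ { _ (px ∷ _) → ¬px px }) ws)))

module _ (_≟ᴬ_ : DecidableEquality A) where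

  Unique-⊆⇒length≤ : {xs ys : List A} → Unique xs → xs ⊆ ys → length xs ≤ length ys
  Unique-⊆⇒length≤ [] _ = z≤n
  Unique-⊆⇒length≤ {x ∷ xs} {ys} (x≢xs ∷ xs!) x∷xs⊆ys = ≤-trans
    (s≤s (Unique-⊆⇒length≤ xs! xs⊆ys-x))
    (filter-notAll (λ y → ¬? (x ≟ᴬ y)) ys (Any.map (λ x≡y x≢y → x≢y x≡y) (x∷xs⊆ys (here refl))))
    where
    xs⊆ys-x : xs ⊆ filter (λ y → ¬? (x ≟ᴬ y)) ys
    xs⊆ys-x z∈xs = ∈-filter⁺ _ (x∷xs⊆ys (there z∈xs)) (All.lookup x≢xs z∈xs)

distinct-≥ : ∀ {xs} w → Unique xs → xs ⊆ w → length xs ≤ distinct w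
distinct-≥ w xs! xs⊆w = Unique-⊆⇒length≤ _≟_ xs! (∈-deduplicate⁺ _≟_ ∘ xs⊆w)

distinct-≤ : ∀ w {xs} → w ⊆ xs → distinct w ≤ length xs
distinct-≤ w w⊆xs = Unique-⊆⇒length≤ _≟_ (deduplicate-! w) (w⊆xs ∘ ∈-deduplicate⁻ _≟_ w)

distinct-map : ∀ {f} → Injective _≡_ _≡_ f → ∀ w → distinct (map f w) ≡ distinct w
distinct-map {f} f-inj w = ≤-antisym
  (begin
    distinct (map f w)                      ≤⟨ distinct-≤ (map f w) (Subset.map⁺ f (∈-deduplicate⁺ _≟_)) ⟩
    length (map f (deduplicate _≟_ w))      ≡⟨ length-map f (deduplicate _≟_ w) ⟩
    distinct w                              ∎)
  (begin
    distinct w                              ≡⟨ length-map f (deduplicate _≟_ w) ⟨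
    length (map f (deduplicate _≟_ w))      ≤⟨ distinct-≥ (map f w) (Unique.map⁺ f-inj (deduplicate-! w))
                                                          (Subset.map⁺ f (∈-deduplicate⁻ _≟_ w)) ⟩
    distinct (map f w)                      ∎)
  where open ≤-Reasoning

∈⇒≤maxW : ∀ {x w} → x ∈ w → x ≤ maxW w
∈⇒≤maxW {w = y ∷ w} (here refl) = m≤m⊔n y (maxW w)
∈⇒≤maxW {w = y ∷ w} (there x∈w) = ≤-trans (∈⇒≤maxW x∈w) (m≤n⊔m y (maxW w))

maxW≤ : ∀ {m w} → All (_≤ m) w → maxW w ≤ m
maxW≤ []          = z≤n
maxW≤ (y≤m ∷ w≤m) = ⊔-lub y≤m (maxW≤ w≤m)

range1≡applyUpTo : ∀ m → range1 m ≡ applyUpTo suc m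
range1≡applyUpTo zero    = refl
range1≡applyUpTo (suc m) = trans (cong (_++ [ suc m ]) (range1≡applyUpTo m)) (applyUpTo-∷ʳ suc m)

length-range1 : ∀ m → length (range1 m) ≡ m
length-range1 m = trans (cong length (range1≡applyUpTo m)) (length-applyUpTo suc m)

Unique-range1 : ∀ m → Unique (range1 m)
Unique-range1 m =
  subst Unique (sym (range1≡applyUpTo m)) (Unique.applyUpTo⁺₁ suc m (λ i<j _ → <⇒≢ (s≤s i<j)))

∈-range1⁻ : ∀ {x m} → x ∈ range1 m → 1 ≤ x × x ≤ m
∈-range1⁻ {m = m} x∈ with ∈-applyUpTo⁻ suc (subst (_ ∈_) (range1≡applyUpTo m) x∈)
... | _ , i<m , refl = s≤s z≤n , i<m

range1-≤ : ∀ m → All (_≤ m) (range1 m)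
range1-≤ m = All.tabulate (proj₂ ∘ ∈-range1⁻)

skip : ℕ → ℕ → ℕ
skip j x with x ≤? j
... | yes _ = x
... | no  _ = suc x

skip-≤ : ∀ {j x} → x ≤ j → skip j x ≡ x
skip-≤ {j} {x} x≤j with x ≤? j
... | yes _   = refl
... | no  x≰j = contradiction x≤j x≰j

skip-> : ∀ {j x} → j < x → skip j x ≡ suc x
skip-> {j} {x} j<x with x ≤? j
... | yes x≤j = contradiction x≤j (<⇒≱ j<x)
... | no  _   = refl

skip-mono : ∀ j → skip j Preserves _<_ ⟶ _<_
skip-mono j {x} {y} x<y with x ≤? j | y ≤? j
... | yes _   | yes _   = x<y
... | yes _   | no  _   = m≤n⇒m≤1+n x<y
... | no  x≰j | yes y≤j = contradiction (<-trans (≰⇒> x≰j) x<y) (≤⇒≯ y≤j)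
... | no  _   | no  _   = s≤s x<y

range1-skip : ∀ {j m} → j ≤ m → filter (λ x → ¬? (suc j ≟ x)) (range1 (suc m)) ≡ map (skip j) (range1 m)
range1-skip {j} {zero} z≤n = refl
range1-skip {j} {suc m} j≤1+m with m≤n⇒m<n∨m≡n j≤1+m
... | inj₁ (s≤s j≤m) = begin
  filter F (range1 (suc m) ++ [ suc (suc m) ])         ≡⟨ filter-++ F (range1 (suc m)) _ ⟩
  filter F (range1 (suc m)) ++ filter F [ suc (suc m) ] ≡⟨ cong₂ _++_ (range1-skip j≤m)
                                                                     (filter-accept F (<⇒≢ (s≤s (s≤s j≤m)))) ⟩
  map (skip j) (range1 m) ++ [ suc (suc m) ]            ≡⟨ cong (λ y → map (skip j) (range1 m) ++ [ y ])
                                                                (skip-> (s≤s j≤m)) ⟨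
  map (skip j) (range1 m) ++ [ skip j (suc m) ]         ≡⟨ map-++ (skip j) (range1 m) _ ⟨
  map (skip j) (range1 (suc m))                         ∎
  where
  open ≡-Reasoning
  F = λ x → ¬? (suc j ≟ x)
... | inj₂ refl = begin
  filter F (range1 (suc m) ++ [ suc (suc m) ])          ≡⟨ filter-++ F (range1 (suc m)) _ ⟩
  filter F (range1 (suc m)) ++ filter F [ suc (suc m) ] ≡⟨ cong₂ _++_ (filter-all F below)
                                                                     (filter-reject F (λ ne → ne refl)) ⟩
  range1 (suc m) ++ []                                  ≡⟨ ++-identityʳ _ ⟩
  range1 (suc m)                                        ≡⟨ map-id-local (All.map skip-≤ (range1-≤ (suc m))) ⟨
  map (skip (suc m)) (range1 (suc m))                   ∎
  where
  open ≡-Reasoning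
  F = λ x → ¬? (suc (suc m) ≟ x)
  below : All (λ x → suc (suc m) ≢ x) (range1 (suc m))
  below = All.map (λ x≤1+m → <⇒≢ (s≤s x≤1+m) ∘ sym) (range1-≤ (suc m))

words≡wordsOver : ∀ m n → words m n ≡ wordsOver (range1 m) n
words≡wordsOver m zero    = refl
words≡wordsOver m (suc n) = cong (λ ws → concatMap (λ x → map (x ∷_) ws) (range1 m)) (words≡wordsOver m n)

words-All : ∀ m n → All (λ w → length w ≡ n × All (_∈ range1 m) w) (words m n)
words-All m n = subst (All _) (sym (words≡wordsOver m n)) (wordsOver-All (range1 m) n)

words-avoiding : ∀ {j m} n → j ≤ m →
  filter (all? (λ x → ¬? (suc j ≟ x))) (words (suc m) n) ≡ map (map (skip j)) (words m n)
words-avoiding {j} {m} n j≤m = begin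
  filter (all? F) (words (suc m) n)             ≡⟨ cong (filter (all? F)) (words≡wordsOver (suc m) n) ⟩
  filter (all? F) (wordsOver (range1 (suc m)) n) ≡⟨ filter-all?-wordsOver F (range1 (suc m)) n ⟩
  wordsOver (filter F (range1 (suc m))) n        ≡⟨ cong (λ as → wordsOver as n) (range1-skip j≤m) ⟩
  wordsOver (map (skip j) (range1 m)) n          ≡⟨ wordsOver-map (skip j) (range1 m) n ⟩
  map (map (skip j)) (wordsOver (range1 m) n)    ≡⟨ cong (map (map (skip j))) (words≡wordsOver m n) ⟨
  map (map (skip j)) (words m n)                 ∎
  where
  open ≡-Reasoning
  F = λ x → ¬? (suc j ≟ x)

insertAll : Tableau → Word → Tableau
insertAll = foldl (λ t x → insertT x t)

module _ {f : ℕ → ℕ} (f-mono : f Preserves _<_ ⟶ _<_) where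

  strictlyMonotone⇒reflects-< : ∀ {x y} → f x < f y → x < y
  strictlyMonotone⇒reflects-< {x} {y} fx<fy with <-cmp x y
  ... | tri< x<y _ _ = x<y
  ... | tri≈ _ refl _ = contradiction fx<fy (<-irrefl refl)
  ... | tri> _ _ y<x = contradiction fx<fy (<-asym (f-mono y<x))

  strictlyMonotone⇒injective : Injective _≡_ _≡_ f
  strictlyMonotone⇒injective {x} {y} fx≡fy with <-cmp x y
  ... | tri< x<y _ _ = contradiction (f-mono x<y) (<-irrefl fx≡fy)
  ... | tri≈ _ x≡y _ = x≡y
  ... | tri> _ _ y<x = contradiction (f-mono y<x) (<-irrefl (sym fx≡fy))

  <ᵇ-relabel : ∀ x y → (f x <ᵇ f y) ≡ (x <ᵇ y)
  <ᵇ-relabel x y = does-⇔ (mk⇔ strictlyMonotone⇒reflects-< f-mono) (f x <? f y) (x <? y)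

  insertRow-relabel : ∀ x r →
    insertRow (f x) (map f r) ≡ Product.map (map f) (Maybe.map f) (insertRow x r)
  insertRow-relabel x [] = refl
  insertRow-relabel x (y ∷ ys) rewrite <ᵇ-relabel x y with x <ᵇ y
  ... | true = refl
  ... | false rewrite insertRow-relabel x ys with insertRow x ys
  ...   | _ = refl

  insertT-relabel : ∀ x t → insertT (f x) (map (map f) t) ≡ map (map f) (insertT x t)
  insertT-relabel x [] = refl
  insertT-relabel x (r ∷ rs) rewrite insertRow-relabel x r with insertRow x r
  ... | r′ , nothing = refl
  ... | r′ , just y  = cong (map f r′ ∷_) (insertT-relabel y rs)

  insertAll-relabel : ∀ t w → insertAll (map (map f) t) (map f w) ≡ map (map f) (insertAll t w)
  insertAll-relabel t [] = refl
  insertAll-relabel t (x ∷ w) rewrite insertT-relabel x t = insertAll-relabel (insertT x t) w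

  P-relabel : ∀ w → P (map f w) ≡ map (map f) (P w)
  P-relabel = insertAll-relabel []

  InC-relabel : ∀ u w → InC (map f u) (map f w) ⇔ InC u w
  InC-relabel u w = mk⇔ to from
    where
    open ≡-Reasoning
    P-relabel-++ : ∀ v v′ → P (map f v ++ map f v′) ≡ map (map f) (P (v ++ v′))
    P-relabel-++ v v′ = trans (cong P (sym (map-++ f v v′))) (P-relabel (v ++ v′))
    to : InC (map f u) (map f w) → InC u w
    to eq = map-injective (map-injective strictlyMonotone⇒injective) (begin
      map (map f) (P (u ++ w))   ≡⟨ P-relabel-++ u w ⟨
      P (map f u ++ map f w)     ≡⟨ eq ⟩
      P (map f w ++ map f u)     ≡⟨ P-relabel-++ w u ⟩
      map (map f) (P (w ++ u))   ∎)
    from : InC u w → InC (map f u) (map f w)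
    from eq = begin
      P (map f u ++ map f w)     ≡⟨ P-relabel-++ u w ⟩
      map (map f) (P (u ++ w))   ≡⟨ cong (map (map f)) eq ⟩
      map (map f) (P (w ++ u))   ≡⟨ P-relabel-++ w u ⟨
      P (map f w ++ map f u)     ∎

consFirstRow : ℕ → Tableau → Tableau
consFirstRow x [] = [ [ x ] ]
consFirstRow x (r ∷ rs) = (x ∷ r) ∷ rs

insertT-consFirstRow : ∀ {x y} t → x ≤ y → insertT y (consFirstRow x t) ≡ consFirstRow x (insertT y t)
insertT-consFirstRow {x} {y} [] x≤y rewrite dec-false (y <? x) (≤⇒≯ x≤y) = refl
insertT-consFirstRow {x} {y} (r ∷ rs) x≤y rewrite dec-false (y <? x) (≤⇒≯ x≤y) with insertRow y r
... | _ , nothing = refl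
... | _ , just _  = refl

insertAll-consFirstRow : ∀ {x} t w → All (x ≤_) w →
  insertAll (consFirstRow x t) w ≡ consFirstRow x (insertAll t w)
insertAll-consFirstRow t [] [] = refl
insertAll-consFirstRow t (y ∷ w) (x≤y ∷ x≤w)
  rewrite insertT-consFirstRow t x≤y = insertAll-consFirstRow (insertT y t) w x≤w

FirstEntryAbove : ℕ → Tableau → Set
FirstEntryAbove x ((y ∷ _) ∷ _) = x < y
FirstEntryAbove x _ = ⊥

insertT-FirstEntryAbove : ∀ {x y} t → x < y → FirstEntryAbove x t → FirstEntryAbove x (insertT y t)
insertT-FirstEntryAbove {y = y} ((z ∷ zs) ∷ rs) x<y x<z with y <ᵇ z
... | true = x<y
... | false with insertRow y zs
...   | _ , nothing = x<z
...   | _ , just _  = x<z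

insertAll-FirstEntryAbove : ∀ {x} t w → All (x <_) w → FirstEntryAbove x t →
  FirstEntryAbove x (insertAll t w)
insertAll-FirstEntryAbove t [] [] above = above
insertAll-FirstEntryAbove t (y ∷ w) (x<y ∷ x<w) above =
  insertAll-FirstEntryAbove (insertT y t) w x<w (insertT-FirstEntryAbove t x<y above)

consFirstRow≢insertT : ∀ {x} t → FirstEntryAbove x t → consFirstRow x t ≢ insertT x t
consFirstRow≢insertT {x} ((y ∷ ys) ∷ rs) x<y eq with x <ᵇ y | <⇒<ᵇ x<y
... | true | _ = 1+n≢n (cong length (proj₂ (∷-injective (proj₁ (∷-injective eq)))))

∈-of-InC-singleton : ∀ {x w} → w ≢ [] → All (x ≤_) w → InC [ x ] w → x ∈ w
∈-of-InC-singleton {x} {w} w≢[] x≤w x·w≡w·x with x ∈? w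
... | yes x∈w = x∈w
... | no  x∉w = ⊥-elim (consFirstRow≢insertT (P w) (above w w≢[] x<w) (begin
  consFirstRow x (P w)  ≡⟨ sym (insertAll-consFirstRow [] w x≤w) ⟩
  P (x ∷ w)             ≡⟨ x·w≡w·x ⟩
  P (w ++ [ x ])        ≡⟨ foldl-++ _ [] w [ x ] ⟩
  insertT x (P w)       ∎))
  where
  open ≡-Reasoning
  x<w : All (x <_) w
  x<w = All.zipWith (λ (x≤y , x≢y) → ≤∧≢⇒< x≤y x≢y) (x≤w , ¬Any⇒All¬ w x∉w)
  above : ∀ v → v ≢ [] → All (x <_) v → FirstEntryAbove x (P v)
  above [] v≢[] _ = contradiction refl v≢[]
  above (y ∷ v) _ (x<y ∷ x<v) = insertAll-FirstEntryAbove [ [ y ] ] v x<v x<y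

module Standardisation
  {Q : Pred Word ℓ} (Q? : Decidable Q)
  (Q-relabel : ∀ {f} → f Preserves _<_ ⟶ _<_ → f 1 ≡ 1 → ∀ w → Q (map f w) ⇔ Q w)
  where

  Counted : ℕ → ℕ → Word → Set ℓ
  Counted k j w = (Q w × distinct w ≡ k) × All (_∈ w) (range1 j)

  counted? : ∀ k j → Decidable (Counted k j)
  counted? k j w = (Q? w ×-dec distinct w ≟ k) ×-dec all? (_∈? w) (range1 j)

  coveringCount : (n j a k : ℕ) → ℕ
  coveringCount n j a k = length (filter (counted? k j) (words (j + a) n))

  packedCount : ℕ → ℕ → ℕ
  packedCount n k = length (filter (λ w → packed? k w ×-dec Q? w) (words k n))

  coveringCount-base : ∀ n j → coveringCount n j 0 j ≡ packedCount n j
  coveringCount-base n j rewrite +-identityʳ j =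
    cong length (filter-≐-local _ _ (All.map (λ (_ , w⊆[j]) → counted⇔packed (All.lookup w⊆[j]))
                                             (words-All j n)))
    where
    counted⇔packed : ∀ {w} → w ⊆ range1 j → Counted j j w ⇔ (Packed j w × Q w)
    counted⇔packed {w} w⊆[j] = mk⇔
      (λ ((q , _) , [j]⊆w) → (maxW-≡ [j]⊆w , [j]⊆w) , q)
      (λ ((_ , [j]⊆w) , q) → (q , distinct-≡ [j]⊆w) , [j]⊆w)
      where
      maxW-≡ : All (_∈ w) (range1 j) → maxW w ≡ j
      maxW-≡ [j]⊆w = ≤-antisym (maxW≤ (All.tabulate (proj₂ ∘ ∈-range1⁻ ∘ w⊆[j]))) (top j [j]⊆w)
        where
        top : ∀ m → All (_∈ w) (range1 m) → m ≤ maxW w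
        top zero    _      = z≤n
        top (suc m) [m]⊆w = ∈⇒≤maxW (proj₂ (∷ʳ⁻ [m]⊆w))
      distinct-≡ : All (_∈ w) (range1 j) → distinct w ≡ j
      distinct-≡ [j]⊆w = ≤-antisym
        (subst (distinct w ≤_) (length-range1 j) (distinct-≤ w w⊆[j]))
        (subst (_≤ distinct w) (length-range1 j) (distinct-≥ w (Unique-range1 j) (All.lookup [j]⊆w)))

  coveringCount-excess : ∀ n j i → coveringCount n j 0 (suc i + j) ≡ 0
  coveringCount-excess n j i = cong length (filter-none (counted? (suc i + j) j)
    (All.map (λ (_ , w⊆[j+0]) ((_ , distinct≡) , _) → too-many distinct≡ w⊆[j+0]) (words-All (j + 0) n)))
    where
    too-many : ∀ {w} → distinct w ≡ suc i + j → All (_∈ range1 (j + 0)) w → ⊥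
    too-many {w} distinct≡ w⊆ = <⇒≱ (s≤s (m≤n+m j i)) (begin
      suc i + j                ≡⟨ distinct≡ ⟨
      distinct w               ≤⟨ distinct-≤ w (All.lookup w⊆) ⟩
      length (range1 (j + 0))  ≡⟨ length-range1 (j + 0) ⟩
      j + 0                    ≡⟨ +-identityʳ j ⟩
      j                        ∎)
      where open ≤-Reasoning

  coveringCount-deficient : ∀ n j a → coveringCount n (suc j) a j ≡ 0
  coveringCount-deficient n j a = cong length (filter-none (counted? j (suc j))
    (All.universal (λ w ((_ , distinct≡) , [j+1]⊆w) → 1+n≰n (begin
      suc j                    ≡⟨ length-range1 (suc j) ⟨
      length (range1 (suc j))  ≤⟨ distinct-≥ w (Unique-range1 (suc j)) (All.lookup [j+1]⊆w) ⟩
      distinct w               ≡⟨ distinct≡ ⟩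
      j                        ∎)) (words (suc j + a) n)))
    where open ≤-Reasoning

  Counted-next : ∀ k j → (Counted k j ∩ (suc j ∈_)) ≐ Counted k (suc j)
  Counted-next k j = (λ ((c , [j]⊆w) , j+1∈w) → c , ∷ʳ⁺ [j]⊆w j+1∈w)
                   , (λ (c , [j+1]⊆w) → (c , proj₁ (∷ʳ⁻ [j+1]⊆w)) , proj₂ (∷ʳ⁻ [j+1]⊆w))

  Counted-relabel : ∀ k {j} → 1 ≤ j → (Counted k j ∘ map (skip j)) ≐ Counted k j
  Counted-relabel k {j} 1≤j = (λ {w} → to (relabel⇔ w)) , (λ {w} → from (relabel⇔ w))
    where
    open Equivalence
    skip-injective : Injective _≡_ _≡_ (skip j)
    skip-injective = strictlyMonotone⇒injective (skip-mono j)
    relabel⇔ : ∀ w → Counted k j (map (skip j) w) ⇔ Counted k j w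
    relabel⇔ w = mk⇔
      (λ ((q , d) , cov) → (to Q⇔ q , trans (sym distinct≡) d) , All.zipWith (uncurry to) (fixes , cov))
      (λ ((q , d) , cov) → (from Q⇔ q , trans distinct≡ d) , All.zipWith (uncurry from) (fixes , cov))
      where
      Q⇔ = Q-relabel (skip-mono j) (skip-≤ 1≤j) w
      distinct≡ = distinct-map skip-injective w
      fixes : All (λ x → x ∈ map (skip j) w ⇔ x ∈ w) (range1 j)
      fixes = All.map (λ x≤j → ∈-map-fixpoint skip-injective (skip-≤ x≤j)) (range1-≤ j)

  coveringCount-avoiding : ∀ n {j} a k → 1 ≤ j →
    length (filter (counted? k j ∩? ∁? (suc j ∈?_)) (words (suc (j + a)) n)) ≡ coveringCount n j a k
  coveringCount-avoiding n {j} a k 1≤j = begin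
    length (filter (counted? k j ∩? ∁? (suc j ∈?_)) W)
      ≡⟨ cong length (filter-≐ _ (counted? k j ∩? all? F) ∉⇔all≢ W) ⟩
    length (filter (counted? k j ∩? all? F) W)
      ≡⟨ cong length (filter-∩ (counted? k j) (all? F) W) ⟩
    length (filter (counted? k j) (filter (all? F) W))
      ≡⟨ cong (length ∘ filter (counted? k j)) (words-avoiding n (m≤m+n j a)) ⟩
    length (filter (counted? k j) (map (map (skip j)) ws))
      ≡⟨ cong length (filter-map (counted? k j) (map (skip j)) ws) ⟩
    length (map (map (skip j)) (filter (counted? k j ∘ map (skip j)) ws))
      ≡⟨ length-map (map (skip j)) (filter (counted? k j ∘ map (skip j)) ws) ⟩
    length (filter (counted? k j ∘ map (skip j)) ws)
      ≡⟨ cong length (filter-≐ _ (counted? k j) (Counted-relabel k 1≤j) ws) ⟩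
    coveringCount n j a k
      ∎
    where
    open ≡-Reasoning
    W  = words (suc (j + a)) n
    ws = words (j + a) n
    F = λ x → ¬? (suc j ≟ x)
    ∉⇔all≢ : (Counted k j ∩ ∁ (suc j ∈_)) ≐ (Counted k j ∩ All (suc j ≢_))
    ∉⇔all≢ = (λ (c , j+1∉w) → c , ¬Any⇒All¬ _ j+1∉w) , (λ (c , j+1≢w) → c , All¬⇒¬Any j+1≢w)

  coveringCount-step : ∀ n {j} a k → 1 ≤ j →
    coveringCount n j (suc a) k ≡ coveringCount n (suc j) a k + coveringCount n j a k
  coveringCount-step n {j} a k 1≤j = begin
    coveringCount n j (suc a) k
      ≡⟨ cong (λ m → length (filter (counted? k j) (words m n))) (+-suc j a) ⟩
    length (filter (counted? k j) W)
      ≡⟨ length-filter-∩∁ (counted? k j) (suc j ∈?_) W ⟩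
    length (filter (counted? k j ∩? (suc j ∈?_)) W) + length (filter (counted? k j ∩? ∁? (suc j ∈?_)) W)
      ≡⟨ cong₂ _+_ (cong length (filter-≐ _ (counted? k (suc j)) (Counted-next k j) W))
                   (coveringCount-avoiding n a k 1≤j) ⟩
    coveringCount n (suc j) a k + coveringCount n j a k
      ∎
    where
    open ≡-Reasoning
    W = words (suc (j + a)) n

  coveringCount-closed : ∀ n {j} → 1 ≤ j → ∀ a i →
    coveringCount n j a (i + j) ≡ (a C i) * packedCount n (i + j)
  -- The first three clauses use that a C 0 and 0 C suc i compute to 1 and 0.
  coveringCount-closed n {j} 1≤j zero zero =
    trans (coveringCount-base n j) (sym (+-identityʳ _))
  coveringCount-closed n {j} 1≤j zero (suc i) = coveringCount-excess n j i
  coveringCount-closed n {j} 1≤j (suc a) zero = begin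
    coveringCount n j (suc a) j                          ≡⟨ coveringCount-step n a j 1≤j ⟩
    coveringCount n (suc j) a j + coveringCount n j a j  ≡⟨ cong₂ _+_ (coveringCount-deficient n j a)
                                                                     (coveringCount-closed n 1≤j a zero) ⟩
    (suc a C 0) * packedCount n j                        ∎
    where open ≡-Reasoning
  coveringCount-closed n {j} 1≤j (suc a) (suc i) = begin
    coveringCount n j (suc a) k
      ≡⟨ coveringCount-step n a k 1≤j ⟩
    coveringCount n (suc j) a k + coveringCount n j a k
      ≡⟨ cong₂ _+_ shifted (coveringCount-closed n 1≤j a (suc i)) ⟩
    (a C i) * packedCount n k + (a C suc i) * packedCount n k
      ≡⟨ *-distribʳ-+ (packedCount n k) (a C i) (a C suc i) ⟨
    (a C i + a C suc i) * packedCount n k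
      ≡⟨ cong (_* packedCount n k) (nCk+nC[k+1]≡[n+1]C[k+1] a i) ⟩
    (suc a C suc i) * packedCount n k
      ∎
    where
    open ≡-Reasoning
    k = suc i + j
    shifted : coveringCount n (suc j) a k ≡ (a C i) * packedCount n k
    shifted = subst (λ k′ → coveringCount n (suc j) a k′ ≡ (a C i) * packedCount n k′)
                    (+-suc i j) (coveringCount-closed n (s≤s z≤n) a i)

InC-1-relabel : ∀ {f} → f Preserves _<_ ⟶ _<_ → f 1 ≡ 1 → ∀ w → InC [ 1 ] (map f w) ⇔ InC [ 1 ] w
InC-1-relabel {f} f-mono f1≡1 w =
  subst (λ u → InC u (map f w) ⇔ InC [ 1 ] w) (cong [_] f1≡1) (InC-relabel f-mono [ 1 ] w)

open Standardisation (inC? [ 1 ]) InC-1-relabel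

c≡coveringCount : ∀ {n} → 1 ≤ n → ∀ a k → c n (suc a) k [ 1 ] ≡ coveringCount n 1 a k
c≡coveringCount {n} 1≤n a k =
  cong length (filter-≐-local _ (counted? k 1) (All.map (uncurry covers-1) (words-All (suc a) n)))
  where
  covers-1 : ∀ {w} → length w ≡ n → All (_∈ range1 (suc a)) w →
             (InC [ 1 ] w × distinct w ≡ k) ⇔ Counted k 1 w
  covers-1 {w} len letters = mk⇔
    (λ (1w≡w1 , d) → (1w≡w1 , d) , ∈-of-InC-singleton w≢[] positive 1w≡w1 ∷ [])
    proj₁
    where
    w≢[] : w ≢ []
    w≢[] refl = contradiction (sym len) (<⇒≢ 1≤n ∘ sym)
    positive : All (1 ≤_) w
    positive = All.map (proj₁ ∘ ∈-range1⁻) letters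

theorem4p3 : (n : ℕ) → n ≥ 1 → (m k : ℕ) → m ≥ 1 → k ≥ 1 →
    c n m k [ 1 ] ≡ b n k * ((m ∸ 1) C (k ∸ 1))
theorem4p3 n n≥1 (suc a) (suc i) _ _ = begin
  c n (suc a) (suc i) [ 1 ]        ≡⟨ c≡coveringCount n≥1 a (suc i) ⟩
  coveringCount n 1 a (suc i)      ≡⟨ cong (coveringCount n 1 a) (+-comm 1 i) ⟩
  coveringCount n 1 a (i + 1)      ≡⟨ coveringCount-closed n ≤-refl a i ⟩
  (a C i) * b n (i + 1)            ≡⟨ cong (λ k → (a C i) * b n k) (+-comm i 1) ⟩
  (a C i) * b n (suc i)            ≡⟨ *-comm (a C i) (b n (suc i)) ⟩
  b n (suc i) * (a C i)            ∎
  where open ≡-Reasoning
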